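{- For all integers $r \ge 3$ and $n \ge 2$, $$m_0(1,n;r) = n^{r-1} - (n-1)^{r-1} + n - 1.$$
   Context: For $1\le \ell\le r$ let $X_\ell=\{1,\dots,n_\ell\}$. An $r$-partite $r$-graph is a family $\mathcal{F}\subseteq X_1\times\dots\times X_r$; for $A$ in this product, $A[\ell]$ denotes its $\ell$-th coordinate. Viewing $X_1,\dots,X_r$ as pairwise disjoint sets, each sequence $A$ is identified with the $r$-element set $\{A[1],\dots,A[r]\}\subseteq X_1\sqcup\dots\sqcup X_r$ (one vertex from each part). Two sequences $A,B$ are disjoint if $A[\ell]\ne B[\ell]$ for all $\ell$; a matching is a collection of pairwise disjoint members; $\nu(\mathcal{F})$ is the maximum size of a matching in $\mathcal{F}$. A transversal of $\mathcal{F}$ is a set $T\subseteq X_1\sqcup\dots\sqcup X_r$ meeting every member of $\mathcal{F}$ (viewed as a set), and $\tau(\mathcal{F})$ is the minimum size of a transversal. For $r\ge 3$ and $n_1\ge\dots\ge n_r>s\ge1$, $m_0(s,n_1,\dots,n_r)$ is the maximum of $|\mathcal{F}|$ over $\mathcal{F}\subseteq X_1\times\dots\times X_r$ with $\nu(\mathcal{F})\le s<\tau(\mathcal{F})$; $m_0(s,n;r)$ denotes $m_0(s,n,\dots,n)$ with $r$ arguments equal to $n$. -}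

module Defs where

open import Data.Nat using (ℕ; _≤_; _<_)
open import Data.Fin using (Fin)
open import Data.Vec using (Vec; lookup)
open import Data.List using (List; length)
open import Data.List.Membership.Propositional using (_∈_)
open import Data.List.Relation.Unary.Unique.Propositional using (Unique)
open import Data.List.Relation.Unary.AllPairs using (AllPairs)
open import Data.Product using (Σ; _×_; _,_; ∃)
open import Relation.Binary.PropositionalEquality using (_≡_; _≢_)

-- A sequence in X₁ × ⋯ × X_r with all X_ℓ = {1,…,n}, encoded as Fin n.
Seq : ℕ → ℕ → Set
Seq r n = Vec (Fin n) r

-- A family F ⊆ X₁ × ⋯ × X_r: a duplicate-free list of sequences; |F| = length.
Family : ℕ → ℕ → Set
Family r n = List (Seq r n)

Disjoint : ∀ {r n} → Seq r n → Seq r n → Set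
Disjoint {r} A B = (ℓ : Fin r) → lookup A ℓ ≢ lookup B ℓ

IsMatching : ∀ {r n} → Family r n → List (Seq r n) → Set
IsMatching F M = Unique M × (∀ {A} → A ∈ M → A ∈ F) × AllPairs Disjoint M

νLe : ∀ {r n} → Family r n → ℕ → Set
νLe F s = ∀ M → IsMatching F M → length M ≤ s

-- Vertices of X₁ ⊔ ⋯ ⊔ X_r: a part index ℓ and an element of X_ℓ.
Vertex : ℕ → ℕ → Set
Vertex r n = Fin r × Fin n

IsTransversal : ∀ {r n} → Family r n → List (Vertex r n) → Set
IsTransversal F T = Unique T ×
  (∀ {A} → A ∈ F → Σ (Vertex _ _) λ v → v ∈ T × (lookup A (Data.Product.proj₁ v) ≡ Data.Product.proj₂ v))

τGt : ∀ {r n} → Family r n → ℕ → Set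
τGt F s = ∀ T → IsTransversal F T → s < length T

Admissible : ∀ {r n} → ℕ → Family r n → Set
Admissible s F = Unique F × νLe F s × τGt F s

IsM0 : ℕ → ℕ → ℕ → ℕ → Set
IsM0 s n r m =
  (Σ (Family r n) λ F → Admissible s F × length F ≡ m) ×
  (∀ (F : Family r n) → Admissible s F → length F ≤ m)

-- View a family p ⊆ [n]^(1+m) as columns over [n]^m: its shadow is the set of words carrying
-- a point of p, its kernel the set of words carrying at least two. A kernel word meets every
-- shadow word, so the kernel is intersecting and |p| ≤ |shadow| + (n-1)|kernel|. If the
-- kernel is empty or lies in a star, this is bounded through the inequality
-- |P| + |Q| ≤ 1 + n^m - (n-1)^m for nonempty cross-intersecting P, Q ⊆ [n]^m, proved by
-- slicing along the first coordinate. Otherwise the kernel K is nontrivial, the shadow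
-- consists of blockers of K, and |blockers K| + (n-1)|K| is bounded by the theorem one
-- dimension lower, applied for each letter w to the family built from the words carrying a
-- point of K off w, their blockers, and the kernel of K; in dimension 2 there is no
-- nontrivial intersecting K. The bound is attained by {(0, y) : y meets 0} ∪ {(j, 0) : j ≠ 0}.

module Submission where

open import Defs
open import Data.Nat.Properties hiding (_≟_)
open import Algebra.Properties.Semiring.Sum +-*-semiring
  using (sum; sum-syntax; sum-cong-≗; sum-remove; ∑-comm; ∑-distrib-+; *-distribˡ-sum)
open import Data.Bool using (Bool; true; false; T; not; _∧_)
open import Data.Bool.Properties using (T?; T-∧; ∧-identityʳ)
open import Data.Empty using (⊥-elim)
open import Data.Fin using (Fin; zero; suc; punchIn; punchOut; _≟_)
open import Data.Fin.Properties using (any?; punchInᵢ≢i; punchIn-punchOut)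
open import Data.List using (List; []; _∷_; length; filter; cartesianProductWith; allFin)
open import Data.List.Membership.Propositional using (_∈_)
open import Data.List.Membership.Propositional.Properties
  using (∈-filter⁺; ∈-filter⁻; ∈-allFin; ∈-cartesianProductWith⁺)
open import Data.List.Relation.Unary.All as All using ()
open import Data.List.Relation.Unary.AllPairs using ([]; _∷_)
open import Data.List.Relation.Unary.Any as Any using (here; there)
open import Data.List.Relation.Unary.Unique.Propositional using (Unique)
open import Data.List.Relation.Unary.Unique.Propositional.Properties
  using (filter⁺; allFin⁺; cartesianProductWith⁺)
open import Data.Nat using (ℕ; zero; suc; _+_; _*_; _^_; _∸_; _≤_; _<_; z≤n; s≤s)
open import Data.Nat.Tactic.RingSolver using (solve-∀)
open import Data.Product using (∃; ∃₂; _×_; _,_; proj₁; proj₂)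
open import Data.Sum using (_⊎_; inj₁; inj₂)
open import Data.Unit using (tt)
open import Data.Vec using (Vec; []; _∷_; lookup; insertAt; removeAt; replicate)
import Data.Vec.Functional as Vector
open import Data.Vec.Properties as Vec
  using (∷-injective; ∷-injectiveˡ; ∷-injectiveʳ; insertAt-lookup; insertAt-removeAt; lookup-replicate)
open import Function using (_∘_; case_of_)
open import Function.Bundles using (Equivalence)
open import Relation.Binary.PropositionalEquality
open import Relation.Nullary using (¬_; Dec; yes; no; ¬?; _×-dec_)
open import Relation.Nullary.Decidable
  using (⌊_⌋; map′; toWitness; fromWitness; decidable-stable; dec-true; isYes≗does)

𝟙 : Bool → ℕ
𝟙 true  = 1
𝟙 false = 0

𝟙≤1 : ∀ b → 𝟙 b ≤ 1
𝟙≤1 true  = ≤-refl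
𝟙≤1 false = z≤n

¬T⇒T-not : ∀ {b} → ¬ T b → T (not b)
¬T⇒T-not {false} _  = tt
¬T⇒T-not {true}  ¬b = ¬b tt

T-not⇒¬T : ∀ {b} → T (not b) → ¬ T b
T-not⇒¬T {false} _ ()

𝟙-mono : ∀ {a b} → (T a → T b) → 𝟙 a ≤ 𝟙 b
𝟙-mono {false}         _   = z≤n
𝟙-mono {true}  {true}  _   = ≤-refl
𝟙-mono {true}  {false} a⇒b = ⊥-elim (a⇒b tt)

𝟙-pos : ∀ {b} → 0 < 𝟙 b → T b
𝟙-pos {true} _ = tt

𝟙-true : ∀ {b} → T b → 𝟙 b ≡ 1
𝟙-true {true} _ = refl

𝟙-false : ∀ {b} → ¬ T b → 𝟙 b ≡ 0
𝟙-false {false} _  = refl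
𝟙-false {true}  ¬b = ⊥-elim (¬b tt)

𝟙-∨ : ∀ {a b c} → (T a → T b ⊎ T c) → 𝟙 a ≤ 𝟙 b + 𝟙 c
𝟙-∨ {false}                 _ = z≤n
𝟙-∨ {true} {true}           _ = s≤s z≤n
𝟙-∨ {true} {false} {true}   _ = ≤-refl
𝟙-∨ {true} {false} {false} a⇒ with a⇒ tt
... | inj₁ ()
... | inj₂ ()

𝟙-split : ∀ a b → 𝟙 a ≡ 𝟙 (a ∧ b) + 𝟙 (a ∧ not b)
𝟙-split false _     = refl
𝟙-split true  true  = refl
𝟙-split true  false = refl

-- Linear arithmetic by certificate: L ≤ R follows from a sum X ≤ Y of known inequalities
-- once L + Y ≡ R + X, an identity left to the ring solver.
≤-by-cancel : ∀ {L R X Y} → X ≤ Y → L + Y ≡ R + X → L ≤ R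
≤-by-cancel {L} {R} {X} {Y} X≤Y eq =
  +-cancelʳ-≤ Y L R (≤-trans (≤-reflexive eq) (+-monoʳ-≤ R X≤Y))

sum-mono : ∀ {j} {f g : Fin j → ℕ} → (∀ i → f i ≤ g i) → sum f ≤ sum g
sum-mono {zero}  f≤g = z≤n
sum-mono {suc j} f≤g = +-mono-≤ (f≤g zero) (sum-mono (f≤g ∘ suc))

sum-const : ∀ j c → ∑[ i < j ] c ≡ j * c
sum-const zero    c = refl
sum-const (suc j) c = cong (c +_) (sum-const j c)

term≤sum : ∀ {j} (f : Fin j → ℕ) i → f i ≤ sum f
term≤sum {suc j} f i = ≤-trans (m≤m+n (f i) _) (≤-reflexive (sym (sum-remove {i = i} f)))

module _ {j} (f : Fin (suc j) → ℕ) (i : Fin (suc j)) where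

  sum-≤-at : ∀ {c} → (∀ i′ → i′ ≢ i → f i′ ≤ c) → sum f ≤ f i + j * c
  sum-≤-at {c} h = begin
    sum f                           ≡⟨ sum-remove f ⟩
    f i + sum (Vector.removeAt f i) ≤⟨ +-monoʳ-≤ (f i) (sum-mono (λ i′ → h _ (punchInᵢ≢i i i′))) ⟩
    f i + ∑[ _ < j ] c              ≡⟨ cong (f i +_) (sum-const j c) ⟩
    f i + j * c                     ∎
    where open ≤-Reasoning

  sum-≥-at : ∀ {c} → (∀ i′ → i′ ≢ i → c ≤ f i′) → f i + j * c ≤ sum f
  sum-≥-at {c} h = begin
    f i + j * c                     ≡⟨ cong (f i +_) (sum-const j c) ⟨
    f i + ∑[ _ < j ] c              ≤⟨ +-monoʳ-≤ (f i) (sum-mono (λ i′ → h _ (punchInᵢ≢i i i′))) ⟩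
    f i + sum (Vector.removeAt f i) ≡⟨ sum-remove f ⟨
    sum f                           ∎
    where open ≤-Reasoning

  sum-at : ∀ {c} → (∀ i′ → i′ ≢ i → f i′ ≡ c) → sum f ≡ f i + j * c
  sum-at h = ≤-antisym (sum-≤-at (λ i′ ne → ≤-reflexive (h i′ ne)))
                       (sum-≥-at (λ i′ ne → ≤-reflexive (sym (h i′ ne))))

  sum-supported-at : (∀ i′ → i′ ≢ i → f i′ ≡ 0) → sum f ≡ f i
  sum-supported-at h = trans (sum-at h) (trans (cong (f i +_) (*-zeroʳ j)) (+-identityʳ (f i)))

argmax : ∀ {j} (f : Fin (suc j) → ℕ) → ∃ λ i → ∀ i′ → f i′ ≤ f i
argmax {zero}  f = zero , λ { zero → ≤-refl }
argmax {suc j} f with argmax (f ∘ suc)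
... | i , max with f zero ≤? f (suc i)
...   | yes f0≤ = suc i , λ { zero → f0≤ ; (suc i′) → max i′ }
...   | no  f0≰ = zero , λ { zero → ≤-refl ; (suc i′) → ≤-trans (max i′) (<⇒≤ (≰⇒> f0≰)) }

argmax-except : ∀ {j} (f : Fin (suc (suc j)) → ℕ) i →
  ∃ λ i₂ → i₂ ≢ i × ∀ i′ → i′ ≢ i → f i′ ≤ f i₂
argmax-except f i with argmax (Vector.removeAt f i)
... | i₂ , max = punchIn i i₂ , punchInᵢ≢i i i₂ , λ i′ i′≢i →
  subst (λ x → f x ≤ f (punchIn i i₂)) (punchIn-punchOut (i′≢i ∘ sym))
        (max (punchOut (i′≢i ∘ sym)))

-- Points of [n]^m, for n = 2 + k, are words Vec (Fin n) m (the Seq m n of Defs), and a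
-- family of points is given by its indicator, so that it can be counted.
module Cube (k : ℕ) where

  n : ℕ
  n = 2 + k

  Word : ℕ → Set
  Word m = Vec (Fin n) m

  Pred : ℕ → Set
  Pred m = Word m → Bool

  _⊆_ : ∀ {m} → Pred m → Pred m → Set
  p ⊆ q = ∀ y → T (p y) → T (q y)

  slice : ∀ {m} → Pred (suc m) → Fin n → Pred m
  slice p v y = p (v ∷ y)

  _≟ʷ_ : ∀ {m} (x y : Word m) → Dec (x ≡ y)
  _≟ʷ_ = Vec.≡-dec _≟_

  ∃ʷ? : ∀ {m} {P : Word m → Set} → (∀ y → Dec (P y)) → Dec (∃ P)
  ∃ʷ? {zero}  P? = map′ ([] ,_) (λ { ([] , h) → h }) (P? [])
  ∃ʷ? {suc m} P? = map′ (λ (v , y , h) → v ∷ y , h) (λ { (v ∷ y , h) → v , y , h })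
                        (any? λ v → ∃ʷ? (P? ∘ (v ∷_)))

  total : ∀ {m} → (Word m → ℕ) → ℕ
  total {zero}  f = f []
  total {suc m} f = ∑[ v < n ] total (λ y → f (v ∷ y))

  total-cong : ∀ {m} {f g : Word m → ℕ} → (∀ y → f y ≡ g y) → total f ≡ total g
  total-cong {zero}  f≡g = f≡g []
  total-cong {suc m} f≡g = sum-cong-≗ (λ v → total-cong (f≡g ∘ (v ∷_)))

  total-mono : ∀ {m} {f g : Word m → ℕ} → (∀ y → f y ≤ g y) → total f ≤ total g
  total-mono {zero}  f≤g = f≤g []
  total-mono {suc m} f≤g = sum-mono (λ v → total-mono (f≤g ∘ (v ∷_)))

  total-+ : ∀ {m} (f g : Word m → ℕ) → total (λ y → f y + g y) ≡ total f + total g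
  total-+ {zero}  f g = refl
  total-+ {suc m} f g = trans (sum-cong-≗ (λ v → total-+ (f ∘ (v ∷_)) (g ∘ (v ∷_))))
                              (∑-distrib-+ (λ v → total (f ∘ (v ∷_))) (λ v → total (g ∘ (v ∷_))))

  total-*ˡ : ∀ {m} c (f : Word m → ℕ) → total (λ y → c * f y) ≡ c * total f
  total-*ˡ {zero}  c f = refl
  total-*ˡ {suc m} c f = trans (sum-cong-≗ (λ v → total-*ˡ c (f ∘ (v ∷_))))
                               (sym (*-distribˡ-sum c (λ v → total (f ∘ (v ∷_)))))

  total-const : ∀ {m} c → total {m} (λ _ → c) ≡ n ^ m * c
  total-const {zero}  c = sym (+-identityʳ c)
  total-const {suc m} c = begin
    ∑[ v < n ] total {m} (λ _ → c) ≡⟨ sum-cong-≗ {n} (λ _ → total-const {m} c) ⟩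
    ∑[ v < n ] (n ^ m * c)         ≡⟨ sum-const n (n ^ m * c) ⟩
    n * (n ^ m * c)                ≡⟨ *-assoc n (n ^ m) c ⟨
    n ^ suc m * c                  ∎
    where open ≡-Reasoning

  total-∑-comm : ∀ {m j} (f : Fin j → Word m → ℕ) →
    total (λ y → ∑[ i < j ] f i y) ≡ ∑[ i < j ] total (f i)
  total-∑-comm {zero}  f = refl
  total-∑-comm {suc m} f = trans (sum-cong-≗ (λ v → total-∑-comm (λ i y → f i (v ∷ y))))
                                 (∑-comm (λ v i → total (f i ∘ (v ∷_))))

  term≤total : ∀ {m} (f : Word m → ℕ) y → f y ≤ total f
  term≤total {zero}  f []      = ≤-refl
  term≤total {suc m} f (v ∷ y) =
    ≤-trans (term≤total (f ∘ (v ∷_)) y) (term≤sum (λ v → total (f ∘ (v ∷_))) v)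

  total-insertAt : ∀ {m} (ℓ : Fin (suc m)) (f : Word (suc m) → ℕ) →
    total f ≡ ∑[ c < n ] total (λ y → f (insertAt y ℓ c))
  total-insertAt         zero    f = refl
  total-insertAt {suc m} (suc ℓ) f = trans (sum-cong-≗ (λ v → total-insertAt ℓ (f ∘ (v ∷_))))
    (∑-comm (λ v c → total (λ y → f (v ∷ insertAt y ℓ c))))

  count : ∀ {m} → Pred m → ℕ
  count p = total (𝟙 ∘ p)

  count-mono : ∀ {m} {p q : Pred m} → p ⊆ q → count p ≤ count q
  count-mono p⊆q = total-mono (λ y → 𝟙-mono (p⊆q y))

  count-pos : ∀ {m} (p : Pred m) {y} → T (p y) → 0 < count p
  count-pos p {y} py = ≤-trans (≤-reflexive (sym (𝟙-true py))) (term≤total (𝟙 ∘ p) y)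

  count-empty : ∀ {m} (p : Pred m) → (∀ y → ¬ T (p y)) → count p ≡ 0
  count-empty {m} p empty =
    trans (total-cong (λ y → 𝟙-false (empty y))) (trans (total-const {m} 0) (*-zeroʳ (n ^ m)))

  count-all : ∀ {m} (p : Pred m) → (∀ y → T (p y)) → count p ≡ n ^ m
  count-all {m} p full =
    trans (total-cong (λ y → 𝟙-true (full y))) (trans (total-const {m} 1) (*-identityʳ (n ^ m)))

  count≤n^m : ∀ {m} (p : Pred m) → count p ≤ n ^ m
  count≤n^m {m} p =
    ≤-trans (total-mono (𝟙≤1 ∘ p)) (≤-reflexive (trans (total-const {m} 1) (*-identityʳ (n ^ m))))

  count-not : ∀ {m} (p : Pred m) → count (not ∘ p) + count p ≡ n ^ m
  count-not {m} p = begin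
    count (not ∘ p) + count p             ≡⟨ total-+ (𝟙 ∘ not ∘ p) (𝟙 ∘ p) ⟨
    total (λ y → 𝟙 (not (p y)) + 𝟙 (p y)) ≡⟨ total-cong (λ y → 𝟙-not+𝟙 (p y)) ⟩
    total {m} (λ _ → 1)                   ≡⟨ total-const {m} 1 ⟩
    n ^ m * 1                             ≡⟨ *-identityʳ (n ^ m) ⟩
    n ^ m                                 ∎
    where
    open ≡-Reasoning
    𝟙-not+𝟙 : ∀ b → 𝟙 (not b) + 𝟙 b ≡ 1
    𝟙-not+𝟙 true  = refl
    𝟙-not+𝟙 false = refl

  count-supported : ∀ {m} (p : Pred m) x → (∀ y → y ≢ x → ¬ T (p y)) → count p ≡ 𝟙 (p x)
  count-supported p []       _       = refl
  count-supported p (x₀ ∷ x) outside = begin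
    ∑[ v < n ] count (slice p v) ≡⟨ sum-supported-at _ x₀ (λ v v≢x₀ →
                                      count-empty _ (λ y → outside (v ∷ y) (v≢x₀ ∘ ∷-injectiveˡ))) ⟩
    count (slice p x₀)           ≡⟨ count-supported (slice p x₀) x (λ y y≢x →
                                      outside (x₀ ∷ y) (y≢x ∘ ∷-injectiveʳ)) ⟩
    𝟙 (p (x₀ ∷ x))               ∎
    where open ≡-Reasoning

  data Meet {m} (a b : Word m) : Set where
    meet-at : ∀ ℓ → lookup a ℓ ≡ lookup b ℓ → Meet a b

  meet? : ∀ {m} (a b : Word m) → Dec (Meet a b)
  meet? a b = map′ (λ (ℓ , eq) → meet-at ℓ eq) (λ { (meet-at ℓ eq) → ℓ , eq })
                   (any? (λ ℓ → lookup a ℓ ≟ lookup b ℓ))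

  Meet-sym : ∀ {m} {a b : Word m} → Meet a b → Meet b a
  Meet-sym (meet-at ℓ eq) = meet-at ℓ (sym eq)

  Meet-head : ∀ {m} v (a b : Word m) → Meet (v ∷ a) (v ∷ b)
  Meet-head v a b = meet-at zero refl

  Meet-∷ : ∀ {m} v w {a b : Word m} → Meet a b → Meet (v ∷ a) (w ∷ b)
  Meet-∷ v w (meet-at ℓ eq) = meet-at (suc ℓ) eq

  Meet-tail : ∀ {m} {v w} {a b : Word m} → v ≢ w → Meet (v ∷ a) (w ∷ b) → Meet a b
  Meet-tail v≢w (meet-at zero    eq) = ⊥-elim (v≢w eq)
  Meet-tail v≢w (meet-at (suc ℓ) eq) = meet-at ℓ eq

  Meet-insertAt : ∀ {m} ℓ {c c′} (a b : Word m) → c ≢ c′ →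
    Meet (insertAt a ℓ c) (insertAt b ℓ c′) → Meet a b
  Meet-insertAt zero    a       b       c≢c′ meet                  = Meet-tail c≢c′ meet
  Meet-insertAt (suc ℓ) (x ∷ a) (y ∷ b) c≢c′ (meet-at zero    eq) = meet-at zero eq
  Meet-insertAt (suc ℓ) (x ∷ a) (y ∷ b) c≢c′ (meet-at (suc ℓ′) eq) =
    Meet-∷ x y (Meet-insertAt ℓ a b c≢c′ (meet-at ℓ′ eq))

  -- Avoiding and blocking words

  -- The searches below are opaque: once unfolded inside goals they normalise to huge terms
  -- and type checking blows up.
  opaque
    avoiding : ∀ {m} → Pred m → Pred m
    avoiding p z = ⌊ ∃ʷ? (λ a → T? (p a) ×-dec ¬? (meet? a z)) ⌋

    avoiding-intro : ∀ {m} (p : Pred m) a z → T (p a) → ¬ Meet a z → T (avoiding p z)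
    avoiding-intro p a z pa ¬meet = fromWitness (a , pa , ¬meet)

    avoiding-elim : ∀ {m} (p : Pred m) {z} → T (avoiding p z) → ∃ λ a → T (p a) × ¬ Meet a z
    avoiding-elim p = toWitness

  blocking : ∀ {m} → Pred m → Pred m
  blocking p z = not (avoiding p z)

  blocking-intro : ∀ {m} (p : Pred m) z → (∀ a → T (p a) → Meet a z) → T (blocking p z)
  blocking-intro p z meets with T? (avoiding p z)
  ... | no ¬avoids = ¬T⇒T-not ¬avoids
  ... | yes avoids with avoiding-elim p avoids
  ...   | a , pa , ¬meet = ⊥-elim (¬meet (meets a pa))

  blocking-elim : ∀ {m} (p : Pred m) {z a} → T (blocking p z) → T (p a) → Meet a z
  blocking-elim p {z} {a} blocks pa =
    decidable-stable (meet? a z) (λ ¬meet → T-not⇒¬T blocks (avoiding-intro p a z pa ¬meet))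

  -- The numbers (n-1)^m and n^m - (n-1)^m

  #avoid : ℕ → ℕ
  #avoid m = suc k ^ m

  -- Words meeting a fixed word agree with it at the first letter, or else differ there
  -- and meet it later.
  #meet : ℕ → ℕ
  #meet zero    = 0
  #meet (suc m) = n ^ m + suc k * #meet m

  n^≡#meet+#avoid : ∀ m → n ^ m ≡ #meet m + #avoid m
  n^≡#meet+#avoid zero    = refl
  n^≡#meet+#avoid (suc m) = begin
    n ^ m + suc k * n ^ m                        ≡⟨ cong (λ x → n ^ m + suc k * x) (n^≡#meet+#avoid m) ⟩
    n ^ m + suc k * (#meet m + #avoid m)         ≡⟨ cong (n ^ m +_) (*-distribˡ-+ (suc k) (#meet m) _) ⟩
    n ^ m + (suc k * #meet m + suc k * #avoid m) ≡⟨ +-assoc (n ^ m) _ _ ⟨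
    #meet (suc m) + #avoid (suc m)               ∎
    where open ≡-Reasoning

  #meet≡n^∸#avoid : ∀ m → #meet m ≡ n ^ m ∸ #avoid m
  #meet≡n^∸#avoid m =
    sym (trans (cong (_∸ #avoid m) (n^≡#meet+#avoid m)) (m+n∸n≡m (#meet m) (#avoid m)))

  1≤#avoid : ∀ m → 1 ≤ #avoid m
  1≤#avoid m = m^n>0 (suc k) m

  suc-k≤#avoid : ∀ m → #avoid m < n ^ m → suc k ≤ #avoid m
  suc-k≤#avoid zero    (s≤s ())
  suc-k≤#avoid (suc m) _ =
    ≤-trans (≤-reflexive (sym (*-identityʳ (suc k)))) (*-monoʳ-≤ (suc k) (1≤#avoid m))

  suc-k*#avoid≤ : ∀ m → suc k * #avoid m ≤ k * n ^ m + 1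
  suc-k*#avoid≤ zero    =
    ≤-reflexive (trans (*-identityʳ (suc k)) (trans (+-comm 1 k) (cong (_+ 1) (sym (*-identityʳ k)))))
  suc-k*#avoid≤ (suc m) = ≤-trans (*-monoʳ-≤ (suc k) (suc-k*#avoid≤ m))
    (≤-by-cancel (*-monoʳ-≤ k (m^n>0 n m)) (identity k (n ^ m)))
    where
    identity : ∀ k N → suc k * (k * N + 1) + k * N ≡ k * ((2 + k) * N) + 1 + k * 1
    identity = solve-∀

  -- AvoidBound (n ^ m) (#avoid m) (count p) (count (avoiding p)): either every word avoids
  -- a member of p, or at least count p + (n-1)^m - 1 words do.
  AvoidBound : (N e a φ : ℕ) → Set
  AvoidBound N e a φ = N ≤ φ ⊎ a + e ≤ suc φ

  AvoidBound-mono : ∀ {N e a a′ φ φ′} → a′ ≤ a → φ ≤ φ′ →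
    AvoidBound N e a φ → AvoidBound N e a′ φ′
  AvoidBound-mono a′≤a φ≤φ′ (inj₁ N≤φ)  = inj₁ (≤-trans N≤φ φ≤φ′)
  AvoidBound-mono a′≤a φ≤φ′ (inj₂ a+e≤) =
    inj₂ (≤-trans (+-monoˡ-≤ _ a′≤a) (≤-trans a+e≤ (s≤s φ≤φ′)))

  AvoidBound-normalise : ∀ {N e a φ} → AvoidBound N e a φ →
    N ≤ φ ⊎ (a + e ≤ suc φ × a + e ≤ N)
  AvoidBound-normalise (inj₁ N≤φ) = inj₁ N≤φ
  AvoidBound-normalise {N} {e} {a} (inj₂ a+e≤) with a + e ≤? N
  ... | yes a+e≤N = inj₂ (a+e≤ , a+e≤N)
  ... | no  a+e≰N = inj₁ (≤-pred (≤-trans (≰⇒> a+e≰N) a+e≤))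

  AvoidBound-single : ∀ {N e a φ} → 0 < a → a ≤ N → suc k * e ≤ k * N + 1 →
    AvoidBound N e a φ → AvoidBound (n * N) (suc k * e) a (suc k * φ)
  AvoidBound-single {N} {e} {a} {φ} 0<a a≤N ke≤ (inj₁ N≤φ) = inj₂ (begin
    a + suc k * e   ≤⟨ +-mono-≤ a≤N ke≤ ⟩
    N + (k * N + 1) ≡⟨ identity k N ⟩
    suc (suc k * N) ≤⟨ s≤s (*-monoʳ-≤ (suc k) N≤φ) ⟩
    suc (suc k * φ) ∎)
    where
    open ≤-Reasoning
    identity : ∀ k N → N + (k * N + 1) ≡ suc (suc k * N)
    identity = solve-∀
  AvoidBound-single {N} {e} {a} {φ} 0<a a≤N ke≤ (inj₂ a+e≤) =
    inj₂ (≤-by-cancel (+-mono-≤ (*-monoʳ-≤ k 0<a) (*-monoʳ-≤ (suc k) a+e≤)) (identity k a e φ))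
    where
    identity : ∀ k a e φ → a + suc k * e + (k * a + suc k * suc φ)
                         ≡ suc (suc k * φ) + (k * 1 + suc k * (a + e))
    identity = solve-∀

  AvoidBound-double : ∀ {N e a₁ a₂ φ₁ φ₂} → 0 < a₂ → a₂ ≤ a₁ → a₁ ≤ N →
    (e < N → suc k ≤ e) → AvoidBound N e a₁ φ₁ → AvoidBound N e a₂ φ₂ →
    AvoidBound (n * N) (suc k * e) (a₁ + suc k * a₂) (φ₂ + suc k * φ₁)
  AvoidBound-double {N} {e} {a₁} {a₂} {φ₁} {φ₂} 0<a₂ a₂≤a₁ a₁≤N suc-k≤e b₁ b₂ =
    by-cases (AvoidBound-normalise {a = a₁} b₁) (AvoidBound-normalise {a = a₂} b₂)
    where
    0<a₁ : 0 < a₁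
    0<a₁ = ≤-trans 0<a₂ a₂≤a₁
    suc-k≤e⇐a₁+e≤N : a₁ + e ≤ N → suc k ≤ e
    suc-k≤e⇐a₁+e≤N a₁+e≤N = suc-k≤e (≤-trans (+-monoˡ-≤ e 0<a₁) a₁+e≤N)
    by-cases : N ≤ φ₁ ⊎ (a₁ + e ≤ suc φ₁ × a₁ + e ≤ N) →
               N ≤ φ₂ ⊎ (a₂ + e ≤ suc φ₂ × a₂ + e ≤ N) →
               AvoidBound (n * N) (suc k * e) (a₁ + suc k * a₂) (φ₂ + suc k * φ₁)
    by-cases (inj₁ N≤φ₁) (inj₁ N≤φ₂) = inj₁ (+-mono-≤ N≤φ₂ (*-monoʳ-≤ (suc k) N≤φ₁))
    by-cases (inj₁ N≤φ₁) (inj₂ (a₂+e≤ , a₂+e≤N)) = inj₂ (≤-by-cancel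
      (+-mono-≤ (+-mono-≤ (+-mono-≤ a₁≤N a₂+e≤) (*-monoʳ-≤ k a₂+e≤N)) (*-monoʳ-≤ (suc k) N≤φ₁))
      (identity k N a₁ a₂ e φ₁ φ₂))
      where
      identity : ∀ k N a₁ a₂ e φ₁ φ₂ →
        a₁ + suc k * a₂ + suc k * e + (N + suc φ₂ + k * N + suc k * φ₁)
        ≡ suc (φ₂ + suc k * φ₁) + (a₁ + (a₂ + e) + k * (a₂ + e) + suc k * N)
      identity = solve-∀
    by-cases (inj₂ (a₁+e≤ , a₁+e≤N)) (inj₁ N≤φ₂) = inj₂ (begin
      a₁ + suc k * a₂ + suc k * e ≤⟨ +-monoˡ-≤ _ (+-monoʳ-≤ a₁ (*-monoʳ-≤ (suc k) a₂≤a₁)) ⟩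
      a₁ + suc k * a₁ + suc k * e ≡⟨ identity₁ k a₁ e ⟩
      a₁ + suc k * (a₁ + e)       ≤⟨ +-monoʳ-≤ a₁ (*-monoʳ-≤ (suc k) a₁+e≤) ⟩
      a₁ + suc k * suc φ₁         ≡⟨ identity₂ k a₁ φ₁ ⟩
      a₁ + suc k + suc k * φ₁
        ≤⟨ +-monoˡ-≤ _ (≤-trans (+-monoʳ-≤ a₁ (suc-k≤e⇐a₁+e≤N a₁+e≤N)) a₁+e≤N) ⟩
      N + suc k * φ₁              ≤⟨ +-monoˡ-≤ _ N≤φ₂ ⟩
      φ₂ + suc k * φ₁             ≤⟨ n≤1+n _ ⟩
      suc (φ₂ + suc k * φ₁)       ∎)
      where
      open ≤-Reasoning
      identity₁ : ∀ k a e → a + suc k * a + suc k * e ≡ a + suc k * (a + e)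
      identity₁ = solve-∀
      identity₂ : ∀ k a φ → a + suc k * suc φ ≡ a + suc k + suc k * φ
      identity₂ = solve-∀
    by-cases (inj₂ (a₁+e≤ , a₁+e≤N)) (inj₂ (a₂+e≤ , _)) = inj₂ (≤-by-cancel
      (+-mono-≤ (+-mono-≤ (+-mono-≤ (*-monoʳ-≤ (suc k) a₁+e≤) a₂+e≤) (suc-k≤e⇐a₁+e≤N a₁+e≤N))
                (*-monoʳ-≤ k a₂≤a₁))
      (identity k a₁ a₂ e φ₁ φ₂))
      where
      identity : ∀ k a₁ a₂ e φ₁ φ₂ →
        a₁ + suc k * a₂ + suc k * e + (suc k * suc φ₁ + suc φ₂ + e + k * a₁)
        ≡ suc (φ₂ + suc k * φ₁) + (suc k * (a₁ + e) + (a₂ + e) + suc k + k * a₂)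
      identity = solve-∀

  avoiding-slice : ∀ {m} (p : Pred (suc m)) {v w} → v ≢ w →
    avoiding (slice p v) ⊆ slice (avoiding p) w
  avoiding-slice p {v} {w} v≢w y y-avoids with avoiding-elim (slice p v) {y} y-avoids
  ... | x , px , ¬meet = avoiding-intro p (v ∷ x) (w ∷ y) px (¬meet ∘ Meet-tail v≢w)

  -- The w-slice of avoiding p contains avoiding (slice p v) for every v ≢ w; compare the
  -- largest slice v₁ of p with the second largest v₂.
  avoiding-large : ∀ {m} (p : Pred m) → 0 < count p →
    AvoidBound (n ^ m) (#avoid m) (count p) (count (avoiding p))
  avoiding-large {zero} p 0<p =
    inj₁ (≤-reflexive (sym (𝟙-true (avoiding-intro p [] [] (𝟙-pos 0<p) λ { (meet-at () _) }))))
  avoiding-large {suc m} p 0<p = by-second-slice (a v₂ ≤? 0)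
    where
    a φ A : Fin n → ℕ
    a v = count (slice p v)
    φ v = count (avoiding (slice p v))
    A w = count (slice (avoiding p) w)
    v₁ v₂ : Fin n
    v₁ = proj₁ (argmax a)
    v₂ = proj₁ (argmax-except a v₁)
    a≤a₁ : ∀ v → a v ≤ a v₁
    a≤a₁ = proj₂ (argmax a)
    v₂≢v₁ : v₂ ≢ v₁
    v₂≢v₁ = proj₁ (proj₂ (argmax-except a v₁))
    count-p≤ : count p ≤ a v₁ + suc k * a v₂
    count-p≤ = sum-≤-at a v₁ (proj₂ (proj₂ (argmax-except a v₁)))
    slice-avoiding≥ : ∀ {v} w → v ≢ w → φ v ≤ A w
    slice-avoiding≥ w v≢w = count-mono (avoiding-slice p v≢w)
    A≥ : A v₁ + suc k * φ v₁ ≤ count (avoiding p)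
    A≥ = sum-≥-at A v₁ (λ w w≢v₁ → slice-avoiding≥ w (w≢v₁ ∘ sym))
    by-second-slice : Dec (a v₂ ≤ 0) →
      AvoidBound (n ^ suc m) (#avoid (suc m)) (count p) (count (avoiding p))
    by-second-slice (yes a₂≤0) = AvoidBound-mono count-p≤a₁ (≤-trans (m≤n+m _ (A v₁)) A≥)
      (AvoidBound-single 0<a₁ (count≤n^m (slice p v₁)) (suc-k*#avoid≤ m)
                         (avoiding-large (slice p v₁) 0<a₁))
      where
      count-p≤a₁ : count p ≤ a v₁
      count-p≤a₁ = ≤-trans count-p≤ (≤-reflexive
        (trans (cong (λ x → a v₁ + suc k * x) (n≤0⇒n≡0 a₂≤0))
               (trans (cong (a v₁ +_) (*-zeroʳ (suc k))) (+-identityʳ _))))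
      0<a₁ : 0 < a v₁
      0<a₁ = ≤-trans 0<p count-p≤a₁
    by-second-slice (no a₂≰0) =
      AvoidBound-mono count-p≤ (≤-trans (+-monoˡ-≤ _ (slice-avoiding≥ v₁ v₂≢v₁)) A≥)
        (AvoidBound-double 0<a₂ (a≤a₁ v₂) (count≤n^m (slice p v₁)) (suc-k≤#avoid m)
                           (avoiding-large (slice p v₁) (≤-trans 0<a₂ (a≤a₁ v₂)))
                           (avoiding-large (slice p v₂) 0<a₂))
      where
      0<a₂ : 0 < a v₂
      0<a₂ = ≰⇒> a₂≰0

  -- Cross-intersecting families

  CrossIntersecting : ∀ {m} → Pred m → Pred m → Set
  CrossIntersecting p q = ∀ {a b} → T (p a) → T (q b) → Meet a b

  cross-intersecting-bound : ∀ {m} (p q : Pred m) → CrossIntersecting p q →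
    ∀ {a b} → T (p a) → T (q b) → count p + count q ≤ suc (#meet m)
  cross-intersecting-bound {m} p q cross pa qb =
    from-avoiding-large (avoiding-large p (count-pos p pa))
    where
    av blk : ℕ
    av = count (avoiding p)
    blk = count (blocking p)
    q≤blk : count q ≤ blk
    q≤blk = count-mono (λ z qz → blocking-intro p z (λ a pa′ → cross pa′ qz))
    blk+av≡n^m : blk + av ≡ n ^ m
    blk+av≡n^m = count-not (avoiding p)
    from-avoiding-large : AvoidBound (n ^ m) (#avoid m) (count p) av →
                          count p + count q ≤ suc (#meet m)
    from-avoiding-large (inj₁ n^m≤av) = ⊥-elim (<⇒≱ (m<n+m av (≤-trans (count-pos q qb) q≤blk))
                                                  (≤-trans (≤-reflexive blk+av≡n^m) n^m≤av))
    from-avoiding-large (inj₂ p+e≤) = +-cancelʳ-≤ (#avoid m) _ _ (begin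
      count p + count q + #avoid m   ≡⟨ +-assoc (count p) _ _ ⟩
      count p + (count q + #avoid m) ≡⟨ cong (count p +_) (+-comm (count q) _) ⟩
      count p + (#avoid m + count q) ≡⟨ +-assoc (count p) _ _ ⟨
      count p + #avoid m + count q   ≤⟨ +-mono-≤ p+e≤ q≤blk ⟩
      suc (av + blk)                 ≡⟨ cong suc (trans (+-comm av blk) blk+av≡n^m) ⟩
      suc (n ^ m)                    ≡⟨ cong suc (n^≡#meet+#avoid m) ⟩
      suc (#meet m + #avoid m)       ∎)
      where open ≤-Reasoning

  size : (Fin n → Bool) → ℕ
  size q = ∑[ v < n ] 𝟙 (q v)

  opaque
    occupied : (Fin n → Bool) → Bool
    occupied q = ⌊ any? (T? ∘ q) ⌋

    occupied-intro : ∀ {q} v → T (q v) → T (occupied q)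
    occupied-intro v qv = fromWitness (v , qv)

    occupied-elim : ∀ {q} → T (occupied q) → ∃ λ v → T (q v)
    occupied-elim = toWitness

    occupiedOff : Fin n → (Fin n → Bool) → Bool
    occupiedOff w q = ⌊ any? (λ v → ¬? (v ≟ w) ×-dec T? (q v)) ⌋

    occupiedOff-intro : ∀ {q w} v → v ≢ w → T (q v) → T (occupiedOff w q)
    occupiedOff-intro v v≢w qv = fromWitness (v , v≢w , qv)

    occupiedOff-elim : ∀ {q w} → T (occupiedOff w q) → ∃ λ v → v ≢ w × T (q v)
    occupiedOff-elim = toWitness

  opaque
    crowded : (Fin n → Bool) → Bool
    crowded q = ⌊ any? (λ v → T? (q v) ×-dec T? (occupiedOff v q)) ⌋

    crowded-intro : ∀ {q} v → T (q v) → T (occupiedOff v q) → T (crowded q)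
    crowded-intro v qv off = fromWitness (v , qv , off)

    crowded-elim : ∀ {q} → T (crowded q) → ∃ λ v → T (q v) × T (occupiedOff v q)
    crowded-elim = toWitness

  crowded⇒occupiedOff : ∀ {q} → T (crowded q) → ∀ w → T (occupiedOff w q)
  crowded⇒occupiedOff crowd w with crowded-elim crowd
  ... | v , qv , off-v with v ≟ w
  ...   | no  v≢w  = occupiedOff-intro v v≢w qv
  ...   | yes refl = off-v

  crowded⇒occupied : ∀ {q} → T (crowded q) → T (occupied q)
  crowded⇒occupied crowd with crowded-elim crowd
  ... | v , qv , _ = occupied-intro v qv

  size≤n : ∀ q → size q ≤ n
  size≤n q = ≤-trans (sum-mono (𝟙≤1 ∘ q)) (≤-reflexive (trans (sum-const n 1) (*-identityʳ n)))

  size-uncrowded : ∀ {q} → ¬ T (crowded q) → size q ≡ 𝟙 (occupied q)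
  size-uncrowded {q} ¬crowd with T? (occupied q)
  ... | no ¬occ = trans (sum-cong-≗ (λ v → 𝟙-false (λ qv → ¬occ (occupied-intro v qv))))
                        (trans (sum-const n 0) (trans (*-zeroʳ n) (sym (𝟙-false ¬occ))))
  ... | yes occ = trans (sum-supported-at (𝟙 ∘ q) v alone) (trans (𝟙-true qv) (sym (𝟙-true occ)))
    where
    v : Fin n
    v = proj₁ (occupied-elim occ)
    qv : T (q v)
    qv = proj₂ (occupied-elim occ)
    alone : ∀ v′ → v′ ≢ v → 𝟙 (q v′) ≡ 0
    alone v′ v′≢v = 𝟙-false (λ qv′ → ¬crowd (crowded-intro v qv (occupiedOff-intro v′ v′≢v qv′)))

  size≤occupied+crowded : ∀ q → size q ≤ 𝟙 (occupied q) + suc k * 𝟙 (crowded q)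
  size≤occupied+crowded q with T? (crowded q)
  ... | no ¬crowd = ≤-trans (≤-reflexive (size-uncrowded ¬crowd)) (m≤m+n _ _)
  ... | yes crowd = ≤-trans (size≤n q) (≤-reflexive (trans (cong (2 +_) (sym (*-identityʳ k)))
    (cong₂ (λ a b → a + suc k * b) (sym (𝟙-true (crowded⇒occupied crowd))) (sym (𝟙-true crowd)))))

  size≤point+occupiedOff : ∀ {q} → ¬ T (crowded q) → ∀ v →
    size q ≤ 𝟙 (q v) + 𝟙 (occupiedOff v q)
  size≤point+occupiedOff {q} ¬crowd v =
    ≤-trans (≤-reflexive (size-uncrowded ¬crowd)) (𝟙-∨ at-v-or-off)
    where
    at-v-or-off : T (occupied q) → T (q v) ⊎ T (occupiedOff v q)
    at-v-or-off occ with occupied-elim occ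
    ... | v′ , qv′ with v′ ≟ v
    ...   | yes refl = inj₁ qv′
    ...   | no v′≢v  = inj₂ (occupiedOff-intro v′ v′≢v qv′)

  occupiedOff≤size : ∀ w q → 𝟙 (occupiedOff w q) ≤ size q
  occupiedOff≤size w q with T? (occupiedOff w q)
  ... | no ¬off = ≤-trans (≤-reflexive (𝟙-false ¬off)) z≤n
  ... | yes off =
    ≤-trans (≤-reflexive (trans (𝟙-true off) (sym (𝟙-true qv)))) (term≤sum (𝟙 ∘ q) v)
    where
    v : Fin n
    v = proj₁ (occupiedOff-elim off)
    qv : T (q v)
    qv = proj₂ (proj₂ (occupiedOff-elim off))

  suc-k*size≤ : ∀ q → suc k * size q ≤ ∑[ w < n ] 𝟙 (occupiedOff w q) + n * k * 𝟙 (crowded q)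
  suc-k*size≤ q with T? (crowded q)
  ... | yes crowd = begin
    suc k * size q                                         ≤⟨ *-monoʳ-≤ (suc k) (size≤n q) ⟩
    suc k * n                                              ≡⟨ identity k ⟩
    n * 1 + n * k * 1                                      ≡⟨ cong (_+ n * k * 1) (sum-const n 1) ⟨
    ∑[ w < n ] 1 + n * k * 1
      ≡⟨ cong₂ _+_ (sum-cong-≗ (λ w → 𝟙-true (crowded⇒occupiedOff crowd w)))
                   (cong (n * k *_) (𝟙-true crowd)) ⟨
    ∑[ w < n ] 𝟙 (occupiedOff w q) + n * k * 𝟙 (crowded q) ∎
    where
    open ≤-Reasoning
    identity : ∀ k → suc k * (2 + k) ≡ (2 + k) * 1 + (2 + k) * k * 1
    identity = solve-∀
  ... | no ¬crowd = begin
    suc k * size q                                         ≡⟨ cong (suc k *_) (size-uncrowded ¬crowd) ⟩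
    suc k * 𝟙 (occupied q)                                 ≤⟨ spread (T? (occupied q)) ⟩
    ∑[ w < n ] 𝟙 (occupiedOff w q)                         ≤⟨ m≤m+n _ _ ⟩
    ∑[ w < n ] 𝟙 (occupiedOff w q) + n * k * 𝟙 (crowded q) ∎
    where
    open ≤-Reasoning
    spread : Dec (T (occupied q)) → suc k * 𝟙 (occupied q) ≤ ∑[ w < n ] 𝟙 (occupiedOff w q)
    spread (no ¬occ) =
      ≤-trans (≤-reflexive (trans (cong (suc k *_) (𝟙-false ¬occ)) (*-zeroʳ (suc k)))) z≤n
    spread (yes occ) = ≤-trans (≤-reflexive (cong (suc k *_) (𝟙-true occ)))
      (≤-trans (m≤n+m _ _) (sum-≥-at (λ w → 𝟙 (occupiedOff w q)) v (λ w w≢v →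
        ≤-reflexive (sym (𝟙-true (occupiedOff-intro v (w≢v ∘ sym) qv))))))
      where
      v : Fin n
      v = proj₁ (occupied-elim occ)
      qv : T (q v)
      qv = proj₂ (occupied-elim occ)

  Intersecting : ∀ {m} → Pred m → Set
  Intersecting p = CrossIntersecting p p

  -- τ > 1: no single vertex (ℓ , c) lies on every member.
  NonTrivial : ∀ {m} → Pred m → Set
  NonTrivial {m} p = ∀ (ℓ : Fin m) c → ∃ λ a → T (p a) × lookup a ℓ ≢ c

  misses-vertex? : ∀ {m} (p : Pred m) ℓ c → Dec (∃ λ a → T (p a) × lookup a ℓ ≢ c)
  misses-vertex? p ℓ c = ∃ʷ? (λ a → T? (p a) ×-dec ¬? (lookup a ℓ ≟ c))

  InStar : ∀ {m} → Pred m → Fin m → Fin n → Set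
  InStar p ℓ c = ∀ y → T (p y) → lookup y ℓ ≡ c

  star-or-nontrivial : ∀ {m} (p : Pred m) → (∃₂ λ ℓ c → InStar p ℓ c) ⊎ NonTrivial p
  star-or-nontrivial p with any? (λ ℓ → any? (λ c → ¬? (misses-vertex? p ℓ c)))
  ... | yes (ℓ , c , none) =
    inj₁ (ℓ , c , λ y py → decidable-stable (lookup y ℓ ≟ c) (λ yℓ≢c → none (y , py , yℓ≢c)))
  ... | no ¬star = inj₂ λ ℓ c → decidable-stable (misses-vertex? p ℓ c) (λ none → ¬star (ℓ , c , none))

  column : ∀ {m} → Pred (suc m) → Word m → Fin n → Bool
  column p y v = p (v ∷ y)

  shadow kernel : ∀ {m} → Pred (suc m) → Pred m
  shadow p y = occupied (column p y)
  kernel p y = crowded (column p y)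

  shadowOff : ∀ {m} → Fin n → Pred (suc m) → Pred m
  shadowOff w p y = occupiedOff w (column p y)

  count-columns : ∀ {m} (p : Pred (suc m)) → count p ≡ total (size ∘ column p)
  count-columns p = sym (total-∑-comm (λ v y → 𝟙 (p (v ∷ y))))

  count≤shadow+kernel : ∀ {m} (p : Pred (suc m)) →
    count p ≤ count (shadow p) + suc k * count (kernel p)
  count≤shadow+kernel p = begin
    count p                                                 ≡⟨ count-columns p ⟩
    total (size ∘ column p)                                 ≤⟨ total-mono (size≤occupied+crowded ∘ column p) ⟩
    total (λ y → 𝟙 (shadow p y) + suc k * 𝟙 (kernel p y))   ≡⟨ total-+ (𝟙 ∘ shadow p) _ ⟩
    count (shadow p) + total (λ y → suc k * 𝟙 (kernel p y))
      ≡⟨ cong (count (shadow p) +_) (total-*ˡ (suc k) (𝟙 ∘ kernel p)) ⟩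
    count (shadow p) + suc k * count (kernel p)             ∎
    where open ≤-Reasoning

  kernel-meets-shadow : ∀ {m} (p : Pred (suc m)) → Intersecting p →
    CrossIntersecting (kernel p) (shadow p)
  kernel-meets-shadow p intersecting ku sx with occupied-elim sx
  ... | w , pwx with occupiedOff-elim (crowded⇒occupiedOff ku w)
  ...   | v , v≢w , pvu = Meet-tail v≢w (intersecting pvu pwx)

  -- The main induction

  MainBound : ℕ → Set
  MainBound m = (p : Pred (suc m)) → Intersecting p → NonTrivial p → count p ≤ #meet m + suc k

  BlockingBound : ℕ → Set
  BlockingBound m = (p : Pred m) → Intersecting p → NonTrivial p →
    count (blocking p) + suc k * count p ≤ #meet m + suc k

  module MainStep {m} (p : Pred (suc (suc m))) (intersecting : Intersecting p)
                  (nontrivial : NonTrivial p) where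

    without-kernel : (∀ y → ¬ T (kernel p y)) → count p ≤ #meet (suc m) + suc k
    without-kernel no-kernel with nontrivial zero zero
    ... | v₀ ∷ y₀ , py₀ , _ with nontrivial zero v₀
    ...   | v₁ ∷ z₀ , pz₀ , v₁≢v₀ = begin
      count p                                               ≡⟨ count-columns p ⟩
      total (size ∘ column p)
        ≤⟨ total-mono (λ y → size≤point+occupiedOff (no-kernel y) v₀) ⟩
      total (λ y → 𝟙 (slice p v₀ y) + 𝟙 (shadowOff v₀ p y))
        ≡⟨ total-+ (𝟙 ∘ slice p v₀) (𝟙 ∘ shadowOff v₀ p) ⟩
      count (slice p v₀) + count (shadowOff v₀ p)
        ≤⟨ cross-intersecting-bound (slice p v₀) (shadowOff v₀ p) cross py₀
                                    (occupiedOff-intro v₁ v₁≢v₀ pz₀) ⟩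
      suc (#meet (suc m))                                   ≡⟨ +-comm 1 _ ⟩
      #meet (suc m) + 1                                     ≤⟨ +-monoʳ-≤ (#meet (suc m)) (s≤s z≤n) ⟩
      #meet (suc m) + suc k                                 ∎
      where
      open ≤-Reasoning
      cross : CrossIntersecting (slice p v₀) (shadowOff v₀ p)
      cross py sz with occupiedOff-elim sz
      ... | w , w≢v₀ , pwz = Meet-tail (w≢v₀ ∘ sym) (intersecting py pwz)

    kernel-in-star : ∀ ℓ c → InStar (kernel p) ℓ c → ∀ {y₀} → T (kernel p y₀) →
      count p ≤ #meet (suc m) + suc k
    kernel-in-star ℓ c star {y₀} ky₀ = begin
      count p                                         ≤⟨ count≤shadow+kernel p ⟩
      count (shadow p) + suc k * count (kernel p)     ≤⟨ +-mono-≤ shadow≤ (*-monoʳ-≤ (suc k) kernel≤) ⟩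
      n ^ m + suc k * count B + suc k * count A       ≡⟨ identity (n ^ m) (count A) (count B) k ⟩
      n ^ m + suc k * (count A + count B)             ≤⟨ +-monoʳ-≤ (n ^ m) (*-monoʳ-≤ (suc k) AB≤) ⟩
      n ^ m + suc k * suc (#meet m)                   ≡⟨ identity′ (n ^ m) (#meet m) k ⟩
      #meet (suc m) + suc k                           ∎
      where
      open ≤-Reasoning
      identity : ∀ N a b k → N + suc k * b + suc k * a ≡ N + suc k * (a + b)
      identity = solve-∀
      identity′ : ∀ N d k → N + suc k * suc d ≡ N + suc k * d + suc k
      identity′ = solve-∀
      ins : Word m → Fin n → Word (suc m)
      ins y c′ = insertAt y ℓ c′
      A B : Pred m
      A y = kernel p (ins y c)
      B y = occupiedOff c (λ c′ → shadow p (ins y c′))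
      shadow≤ : count (shadow p) ≤ n ^ m + suc k * count B
      shadow≤ = begin
        count (shadow p)                                   ≡⟨ total-insertAt ℓ (𝟙 ∘ shadow p) ⟩
        ∑[ c′ < n ] count (λ y → shadow p (ins y c′))
          ≤⟨ sum-≤-at (λ c′ → count (λ y → shadow p (ins y c′))) c (λ c′ c′≢c →
               count-mono {q = B} (λ y s → occupiedOff-intro c′ c′≢c s)) ⟩
        count (λ y → shadow p (ins y c)) + suc k * count B
          ≤⟨ +-monoˡ-≤ _ (count≤n^m (λ y → shadow p (ins y c))) ⟩
        n ^ m + suc k * count B                            ∎
      kernel≤ : count (kernel p) ≤ count A
      kernel≤ = ≤-reflexive (begin-equality
        count (kernel p)                               ≡⟨ total-insertAt ℓ (𝟙 ∘ kernel p) ⟩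
        ∑[ c′ < n ] count (λ y → kernel p (ins y c′))
          ≡⟨ sum-supported-at (λ c′ → count (λ y → kernel p (ins y c′))) c (λ c′ c′≢c →
               count-empty _ (λ y k′ → c′≢c (trans (sym (insertAt-lookup y ℓ c′)) (star _ k′)))) ⟩
        count A                                        ∎)
      cross : CrossIntersecting A B
      cross {y} {z} ay bz with occupiedOff-elim bz
      ... | c′ , c′≢c , s = Meet-insertAt ℓ y z (c′≢c ∘ sym) (kernel-meets-shadow p intersecting ay s)
      a₀ : T (A (removeAt y₀ ℓ))
      a₀ = subst (T ∘ kernel p)
                 (sym (trans (cong (ins (removeAt y₀ ℓ)) (sym (star y₀ ky₀))) (insertAt-removeAt y₀ ℓ))) ky₀
      b₀ : ∃ λ z → T (B z)
      b₀ with nontrivial (suc ℓ) c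
      ... | v ∷ z , pvz , zℓ≢c = removeAt z ℓ , occupiedOff-intro (lookup z ℓ) zℓ≢c
                                   (subst (T ∘ shadow p) (sym (insertAt-removeAt z ℓ)) (occupied-intro v pvz))
      AB≤ : count A + count B ≤ suc (#meet m)
      AB≤ = cross-intersecting-bound A B cross a₀ (proj₂ b₀)

    shadow⊆blocking-kernel : shadow p ⊆ blocking (kernel p)
    shadow⊆blocking-kernel x sx =
      blocking-intro (kernel p) x (λ u ku → kernel-meets-shadow p intersecting ku sx)

    kernel-intersecting : Intersecting (kernel p)
    kernel-intersecting ku ku′ = kernel-meets-shadow p intersecting ku (crowded⇒occupied ku′)

    main-step : BlockingBound (suc m) → count p ≤ #meet (suc m) + suc k
    main-step blocking-bound with ∃ʷ? (T? ∘ kernel p)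
    ... | no no-kernel = without-kernel (λ y ky → no-kernel (y , ky))
    ... | yes (y₀ , ky₀) with star-or-nontrivial (kernel p)
    ...   | inj₁ (ℓ , c , star) = kernel-in-star ℓ c star ky₀
    ...   | inj₂ kernel-nontrivial = begin
      count p                                                ≤⟨ count≤shadow+kernel p ⟩
      count (shadow p) + suc k * count (kernel p)            ≤⟨ +-monoˡ-≤ _ (count-mono shadow⊆blocking-kernel) ⟩
      count (blocking (kernel p)) + suc k * count (kernel p)
        ≤⟨ blocking-bound (kernel p) kernel-intersecting kernel-nontrivial ⟩
      #meet (suc m) + suc k                                  ∎
      where open ≤-Reasoning

  no-nontrivial-intersecting-2 : (p : Pred 2) → Intersecting p → ¬ NonTrivial p
  no-nontrivial-intersecting-2 p intersecting nontrivial
    with nontrivial zero zero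
  ... | a₀ ∷ a₁ ∷ [] , pa , _
    with nontrivial zero a₀ | nontrivial (suc zero) a₁
  ... | b₀ ∷ b₁ ∷ [] , pb , b₀≢a₀ | c₀ ∷ c₁ ∷ [] , pc , c₁≢a₁
    with intersecting pa pb | intersecting pa pc | intersecting pb pc
  ... | meet-at zero a₀≡b₀ | _ | _ = b₀≢a₀ (sym a₀≡b₀)
  ... | _ | meet-at (suc zero) a₁≡c₁ | _ = c₁≢a₁ (sym a₁≡c₁)
  ... | meet-at (suc zero) _ | meet-at zero a₀≡c₀ | meet-at zero b₀≡c₀ =
    b₀≢a₀ (trans b₀≡c₀ (sym a₀≡c₀))
  ... | meet-at (suc zero) a₁≡b₁ | meet-at zero _ | meet-at (suc zero) b₁≡c₁ =
    c₁≢a₁ (trans (sym b₁≡c₁) (sym a₁≡b₁))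

  n*[#meet+suc-k]≤ : ∀ m → n * (#meet (suc (suc m)) + suc k) ≤ #meet (suc (suc (suc m))) + suc k
  n*[#meet+suc-k]≤ m = begin
    n * (d + suc k)                       ≡⟨ identity d k ⟩
    d + suc k * suc k + suc k * d + suc k
      ≤⟨ +-monoˡ-≤ (suc k) (+-monoˡ-≤ (suc k * d) (+-monoʳ-≤ d suc-k²≤e)) ⟩
    d + e + suc k * d + suc k
      ≡⟨ cong (λ x → x + suc k * d + suc k) (n^≡#meet+#avoid (suc (suc m))) ⟨
    #meet (suc (suc (suc m))) + suc k     ∎
    where
    open ≤-Reasoning
    d e : ℕ
    d = #meet (suc (suc m))
    e = #avoid (suc (suc m))
    identity : ∀ d k → (2 + k) * (d + suc k) ≡ d + suc k * suc k + suc k * d + suc k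
    identity = solve-∀
    suc-k²≤e : suc k * suc k ≤ e
    suc-k²≤e = *-monoʳ-≤ (suc k)
      (≤-trans (≤-reflexive (sym (*-identityʳ (suc k)))) (*-monoʳ-≤ (suc k) (1≤#avoid m)))

  module BlockingStep {m} (main-bound : MainBound (suc (suc m))) (p : Pred (suc (suc (suc m))))
                      (intersecting : Intersecting p) (nontrivial : NonTrivial p) where

    off blockingOff : Fin n → Pred (suc (suc m))
    off w = shadowOff w p
    blockingOff w = blocking (off w)

    kernel⊆blockingOff : ∀ w → kernel p ⊆ blockingOff w
    kernel⊆blockingOff w y ky = blocking-intro (off w) y λ z offz → case occupiedOff-elim offz of λ
      (v , _ , pvz) → Meet-sym (kernel-meets-shadow p intersecting {y} {z} ky (occupied-intro v pvz))

    count-blocking≤ : count (blocking p) ≤ ∑[ w < n ] count (blockingOff w)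
    count-blocking≤ = sum-mono λ w → count-mono {p = slice (blocking p) w} λ y blocks →
      blocking-intro (off w) y λ z offz → case occupiedOff-elim offz of λ
        (v , v≢w , pvz) → Meet-tail v≢w (blocking-elim p blocks pvz)

    suc-k*count≤ : suc k * count p ≤ ∑[ w < n ] count (off w) + n * k * count (kernel p)
    suc-k*count≤ = begin
      suc k * count p                         ≡⟨ cong (suc k *_) (count-columns p) ⟩
      suc k * total (size ∘ column p)         ≡⟨ total-*ˡ (suc k) (size ∘ column p) ⟨
      total (λ y → suc k * size (column p y)) ≤⟨ total-mono (suc-k*size≤ ∘ column p) ⟩
      total (λ y → ∑[ w < n ] 𝟙 (off w y) + n * k * 𝟙 (kernel p y))
        ≡⟨ total-+ (λ y → ∑[ w < n ] 𝟙 (off w y)) (λ y → n * k * 𝟙 (kernel p y)) ⟩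
      total (λ y → ∑[ w < n ] 𝟙 (off w y)) + total (λ y → n * k * 𝟙 (kernel p y))
        ≡⟨ cong₂ _+_ (total-∑-comm (λ w → 𝟙 ∘ off w)) (total-*ˡ (n * k) (𝟙 ∘ kernel p)) ⟩
      ∑[ w < n ] count (off w) + n * k * count (kernel p) ∎
      where open ≤-Reasoning

    -- Intersecting, and nontrivial as soon as blockingOff w is nonempty, so that the main
    -- bound one dimension lower applies to it.
    layered : Fin n → Pred (suc (suc (suc m)))
    layered w (zero        ∷ y) = off w y
    layered w (suc zero    ∷ y) = blockingOff w y
    layered w (suc (suc _) ∷ y) = kernel p y

    count-layered : ∀ w →
      count (layered w) ≡ count (off w) + count (blockingOff w) + k * count (kernel p)
    count-layered w =
      trans (cong (λ x → count (off w) + (count (blockingOff w) + x)) (sum-const k (count (kernel p))))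
            (sym (+-assoc (count (off w)) _ _))

    off⟂blockingOff : ∀ w → CrossIntersecting (off w) (blockingOff w)
    off⟂blockingOff w offy blocksz = blocking-elim (off w) blocksz offy

    off⟂kernel : ∀ w → CrossIntersecting (off w) (kernel p)
    off⟂kernel w {y} {z} offy kz with occupiedOff-elim offy
    ... | v , _ , pvy = Meet-sym (kernel-meets-shadow p intersecting {z} {y} kz (occupied-intro v pvy))

    blockingOff⟂kernel : ∀ w → CrossIntersecting (blockingOff w) (kernel p)
    blockingOff⟂kernel w blocksy kz =
      Meet-sym (blocking-elim (off w) blocksy (crowded⇒occupiedOff kz w))

    layered-intersecting : ∀ w → Intersecting (layered w)
    layered-intersecting w {zero        ∷ y} {zero        ∷ z} _ _ = Meet-head zero y z
    layered-intersecting w {zero        ∷ y} {suc zero    ∷ z} a b = Meet-∷ _ _ (off⟂blockingOff w a b)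
    layered-intersecting w {zero        ∷ y} {suc (suc _) ∷ z} a b = Meet-∷ _ _ (off⟂kernel w a b)
    layered-intersecting w {suc zero    ∷ y} {zero        ∷ z} a b = Meet-∷ _ _ (Meet-sym (off⟂blockingOff w b a))
    layered-intersecting w {suc zero    ∷ y} {suc zero    ∷ z} _ _ = Meet-head (suc zero) y z
    layered-intersecting w {suc zero    ∷ y} {suc (suc _) ∷ z} a b = Meet-∷ _ _ (blockingOff⟂kernel w a b)
    layered-intersecting w {suc (suc _) ∷ y} {zero        ∷ z} a b = Meet-∷ _ _ (Meet-sym (off⟂kernel w b a))
    layered-intersecting w {suc (suc _) ∷ y} {suc zero    ∷ z} a b =
      Meet-∷ _ _ (Meet-sym (blockingOff⟂kernel w b a))
    layered-intersecting w {suc (suc _) ∷ y} {suc (suc _) ∷ z} a b =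
      Meet-∷ _ _ (kernel-meets-shadow p intersecting {y} {z} a (crowded⇒occupied b))

    layered-nontrivial : ∀ w {z₀} → T (blockingOff w z₀) → NonTrivial (layered w)
    layered-nontrivial w {z₀} blocks₀ zero zero = suc zero ∷ z₀ , blocks₀ , λ ()
    layered-nontrivial w _ zero (suc c) with nontrivial zero w
    ... | v ∷ y , pvy , v≢w = zero ∷ y , occupiedOff-intro v v≢w pvy , λ ()
    layered-nontrivial w _ (suc ℓ) c with nontrivial (suc ℓ) c
    ... | v ∷ y , pvy , yℓ≢c with v ≟ w
    ...   | no v≢w  = zero ∷ y , occupiedOff-intro v v≢w pvy , yℓ≢c
    ...   | yes refl = suc zero ∷ y , blocking-intro (off w) y blocks , yℓ≢c
      where
      blocks : ∀ z → T (off w z) → Meet z y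
      blocks z offz with occupiedOff-elim offz
      ... | v′ , v′≢w , pv′z = Meet-tail v′≢w (intersecting pv′z pvy)

    count-off≤ : ∀ w → count (off w) ≤ count p
    count-off≤ w =
      ≤-trans (total-mono (λ y → occupiedOff≤size w (column p y))) (≤-reflexive (sym (count-columns p)))

    layer-bound : ∀ w →
      count (off w) + count (blockingOff w) + k * count (kernel p) ≤ #meet (suc (suc m)) + suc k
    layer-bound w with ∃ʷ? (T? ∘ blockingOff w)
    ... | yes (z₀ , blocks₀) = ≤-trans (≤-reflexive (sym (count-layered w)))
      (main-bound (layered w) (layered-intersecting w) (layered-nontrivial w blocks₀))
    ... | no none = begin
      count (off w) + count (blockingOff w) + k * count (kernel p)
        ≡⟨ cong₂ (λ x y → count (off w) + x + k * y) (count-empty _ (λ z b → none (z , b)))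
                 (count-empty _ (λ z kz → none (z , kernel⊆blockingOff w z kz))) ⟩
      count (off w) + 0 + k * 0   ≡⟨ cong₂ _+_ (+-identityʳ _) (*-zeroʳ k) ⟩
      count (off w) + 0           ≡⟨ +-identityʳ _ ⟩
      count (off w)               ≤⟨ count-off≤ w ⟩
      count p                     ≤⟨ main-bound p intersecting nontrivial ⟩
      #meet (suc (suc m)) + suc k ∎
      where open ≤-Reasoning

    blocking-step : count (blocking p) + suc k * count p ≤ #meet (suc (suc (suc m))) + suc k
    blocking-step = begin
      count (blocking p) + suc k * count p
        ≤⟨ +-mono-≤ count-blocking≤ suc-k*count≤ ⟩
      ∑[ w < n ] count (blockingOff w) + (∑[ w < n ] count (off w) + n * k * count (kernel p))
        ≡⟨ regroup ⟩
      ∑[ w < n ] (count (off w) + count (blockingOff w) + k * count (kernel p))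
        ≤⟨ sum-mono layer-bound ⟩
      ∑[ w < n ] (#meet (suc (suc m)) + suc k)
        ≡⟨ sum-const n (#meet (suc (suc m)) + suc k) ⟩
      n * (#meet (suc (suc m)) + suc k)
        ≤⟨ n*[#meet+suc-k]≤ m ⟩
      #meet (suc (suc (suc m))) + suc k ∎
      where
      open ≤-Reasoning
      O B : Fin n → ℕ
      O w = count (off w)
      B w = count (blockingOff w)
      κ : ℕ
      κ = count (kernel p)
      identity : ∀ a b c N k → a + b + N * (k * c) ≡ b + (a + N * k * c)
      identity = solve-∀
      regroup : sum B + (sum O + n * k * κ) ≡ ∑[ w < n ] (O w + B w + k * κ)
      regroup = sym (begin-equality
        ∑[ w < n ] (O w + B w + k * κ)              ≡⟨ ∑-distrib-+ (λ w → O w + B w) (λ _ → k * κ) ⟩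
        ∑[ w < n ] (O w + B w) + ∑[ w < n ] (k * κ) ≡⟨ cong₂ _+_ (∑-distrib-+ O B) (sum-const n (k * κ)) ⟩
        sum O + sum B + n * (k * κ)                 ≡⟨ identity (sum O) (sum B) κ n k ⟩
        sum B + (sum O + n * k * κ)                 ∎)

  main-bound : ∀ m → MainBound (suc (suc m))
  main-bound zero    p intersecting nontrivial = MainStep.main-step p intersecting nontrivial
    λ K K-intersecting K-nontrivial → ⊥-elim (no-nontrivial-intersecting-2 K K-intersecting K-nontrivial)
  main-bound (suc m) p intersecting nontrivial = MainStep.main-step p intersecting nontrivial
    (BlockingStep.blocking-step (main-bound m))

  -- The extremal family

  count-singleton : ∀ {m} (x : Word m) → count (λ y → ⌊ y ≟ʷ x ⌋) ≡ 1
  count-singleton x =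
    trans (count-supported _ x (λ y y≢x y≡x → y≢x (toWitness y≡x))) (𝟙-true (fromWitness refl))

  opaque
    meeting : ∀ {m} → Word m → Pred m
    meeting x y = ⌊ meet? y x ⌋

    meeting-intro : ∀ {m} {x y : Word m} → Meet y x → T (meeting x y)
    meeting-intro = fromWitness

    meeting-elim : ∀ {m} {x y : Word m} → T (meeting x y) → Meet y x
    meeting-elim = toWitness

  count-meeting : ∀ {m} (x : Word m) → count (meeting x) ≡ #meet m
  count-meeting []       = 𝟙-false (λ meets → no-meet (meeting-elim meets))
    where
    no-meet : ¬ Meet [] []
    no-meet (meet-at () _)
  count-meeting {suc m} (x₀ ∷ x) = begin
    ∑[ v < n ] count (slice (meeting (x₀ ∷ x)) v)         ≡⟨ sum-at _ x₀ off-x₀ ⟩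
    count (slice (meeting (x₀ ∷ x)) x₀) + suc k * #meet m
      ≡⟨ cong (_+ suc k * #meet m) (count-all _ (λ y → meeting-intro (Meet-head x₀ y x))) ⟩
    #meet (suc m)                                         ∎
    where
    open ≡-Reasoning
    off-x₀ : ∀ v → v ≢ x₀ → count (slice (meeting (x₀ ∷ x)) v) ≡ #meet m
    off-x₀ v v≢x₀ = trans (≤-antisym
      (count-mono {p = slice (meeting (x₀ ∷ x)) v} {q = meeting x}
                  (λ y h → meeting-intro (Meet-tail v≢x₀ (meeting-elim h))))
      (count-mono {p = meeting x} {q = slice (meeting (x₀ ∷ x)) v}
                  (λ y h → meeting-intro (Meet-∷ v x₀ (meeting-elim h)))))
      (count-meeting x)

  0ʷ : ∀ {m} → Word m
  0ʷ = replicate _ zero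

  extremal : ∀ {m} → Pred (suc m)
  extremal (zero  ∷ y) = meeting 0ʷ y
  extremal (suc _ ∷ y) = ⌊ y ≟ʷ 0ʷ ⌋

  count-extremal : ∀ m → count (extremal {m}) ≡ #meet m + suc k
  count-extremal m = cong₂ _+_ (count-meeting {m} 0ʷ)
    (trans (sum-cong-≗ {suc k} (λ _ → count-singleton (0ʷ {m})))
           (trans (sum-const (suc k) 1) (*-identityʳ (suc k))))

  extremal-intersecting : ∀ {m} → Intersecting (extremal {suc m})
  extremal-intersecting {a = zero ∷ y} {zero ∷ z} _ _ = Meet-head zero y z
  extremal-intersecting {a = zero ∷ y} {suc j ∷ z} ey ez =
    Meet-∷ zero (suc j) (subst (Meet y) (sym (toWitness ez)) (meeting-elim ey))
  extremal-intersecting {a = suc i ∷ y} {zero ∷ z} ey ez =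
    Meet-∷ (suc i) zero (Meet-sym (subst (Meet z) (sym (toWitness ey)) (meeting-elim ez)))
  extremal-intersecting {a = suc i ∷ y} {suc j ∷ z} ey ez =
    Meet-∷ (suc i) (suc j) (subst₂ Meet (sym (toWitness ey)) (sym (toWitness ez)) (Meet-head zero 0ʷ 0ʷ))

  extremal-nontrivial : ∀ {m} → NonTrivial (extremal {suc (suc m)})
  extremal-nontrivial zero zero = suc zero ∷ 0ʷ , fromWitness refl , λ ()
  extremal-nontrivial zero (suc c) = zero ∷ 0ʷ , meeting-intro (Meet-head zero 0ʷ 0ʷ) , λ ()
  extremal-nontrivial (suc ℓ) (suc c) = zero ∷ 0ʷ , meeting-intro (Meet-head zero 0ʷ 0ʷ) ,
    λ eq → 0≢suc (trans (sym (lookup-replicate ℓ zero)) eq)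
    where
    0≢suc : ∀ {j} {c : Fin j} → zero ≢ suc c
    0≢suc ()
  extremal-nontrivial (suc zero) zero =
    zero ∷ suc zero ∷ 0ʷ , meeting-intro (meet-at (suc zero) refl) , λ ()
  extremal-nontrivial {m} (suc (suc ℓ)) zero =
    zero ∷ zero ∷ ones , meeting-intro (meet-at zero refl) ,
    λ eq → suc≢0 (trans (sym (lookup-replicate ℓ (suc zero))) eq)
    where
    ones : Word (suc m)
    ones = replicate (suc m) (suc zero)
    suc≢0 : ∀ {j} {c : Fin j} → suc c ≢ zero
    suc≢0 ()

  -- Families as lists

  _∖_ : ∀ {m} → Pred m → Word m → Pred m
  (p ∖ x) y = p y ∧ not ⌊ y ≟ʷ x ⌋

  ∖-intro : ∀ {m} {p : Pred m} {x y} → T (p y) → y ≢ x → T ((p ∖ x) y)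
  ∖-intro py y≢x = Equivalence.from T-∧ (py , ¬T⇒T-not (y≢x ∘ toWitness))

  ∖-elim : ∀ {m} {p : Pred m} {x y} → T ((p ∖ x) y) → T (p y) × y ≢ x
  ∖-elim h with Equivalence.to T-∧ h
  ... | py , y≢x = py , T-not⇒¬T y≢x ∘ fromWitness

  count-∖ : ∀ {m} (p : Pred m) x → count p ≡ 𝟙 (p x) + count (p ∖ x)
  count-∖ p x = begin
    count p                                            ≡⟨ total-cong (λ y → 𝟙-split (p y) ⌊ y ≟ʷ x ⌋) ⟩
    total (λ y → 𝟙 (p y ∧ ⌊ y ≟ʷ x ⌋) + 𝟙 ((p ∖ x) y))
      ≡⟨ total-+ (λ y → 𝟙 (p y ∧ ⌊ y ≟ʷ x ⌋)) (𝟙 ∘ (p ∖ x)) ⟩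
    count (λ y → p y ∧ ⌊ y ≟ʷ x ⌋) + count (p ∖ x)     ≡⟨ cong (_+ count (p ∖ x)) at-x ⟩
    𝟙 (p x) + count (p ∖ x)                            ∎
    where
    open ≡-Reasoning
    at-x : count (λ y → p y ∧ ⌊ y ≟ʷ x ⌋) ≡ 𝟙 (p x)
    at-x = begin
      count (λ y → p y ∧ ⌊ y ≟ʷ x ⌋)
        ≡⟨ count-supported (λ y → p y ∧ ⌊ y ≟ʷ x ⌋) x
             (λ y y≢x h → y≢x (toWitness (proj₂ (Equivalence.to (T-∧ {p y}) h)))) ⟩
      𝟙 (p x ∧ ⌊ x ≟ʷ x ⌋)
        ≡⟨ cong (λ b → 𝟙 (p x ∧ b)) (trans (isYes≗does (x ≟ʷ x)) (dec-true (x ≟ʷ x) refl)) ⟩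
      𝟙 (p x ∧ true)                 ≡⟨ cong 𝟙 (∧-identityʳ (p x)) ⟩
      𝟙 (p x)                        ∎

  length≤count : ∀ {m} (p : Pred m) {F : List (Word m)} → Unique F → (∀ {y} → y ∈ F → T (p y)) →
    length F ≤ count p
  length≤count p {[]}    _              _   = z≤n
  length≤count p {x ∷ F} (x∉F ∷ unique) F⊆p = begin
    suc (length F)
      ≤⟨ s≤s (length≤count (p ∖ x) unique λ y∈F →
                ∖-intro {p = p} (F⊆p (there y∈F)) (All.lookup x∉F y∈F ∘ sym)) ⟩
    suc (count (p ∖ x))     ≡⟨ cong (_+ count (p ∖ x)) (𝟙-true (F⊆p (here refl))) ⟨
    𝟙 (p x) + count (p ∖ x) ≡⟨ count-∖ p x ⟨
    count p                 ∎
    where open ≤-Reasoning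

  count≤length : ∀ {m} (p : Pred m) (F : List (Word m)) → (∀ y → T (p y) → y ∈ F) →
    count p ≤ length F
  count≤length p []      p⊆F = ≤-reflexive (count-empty p (λ y py → ∉[] (p⊆F y py)))
    where
    ∉[] : ∀ {y} → ¬ y ∈ []
    ∉[] ()
  count≤length p (x ∷ F) p⊆F = begin
    count p                 ≡⟨ count-∖ p x ⟩
    𝟙 (p x) + count (p ∖ x) ≤⟨ +-mono-≤ (𝟙≤1 (p x)) (count≤length (p ∖ x) F p∖x⊆F) ⟩
    suc (length F)          ∎
    where
    open ≤-Reasoning
    p∖x⊆F : ∀ y → T ((p ∖ x) y) → y ∈ F
    p∖x⊆F y h with ∖-elim {p = p} h
    ... | py , y≢x with p⊆F y py
    ...   | here y≡x  = ⊥-elim (y≢x y≡x)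
    ...   | there y∈F = y∈F

  allWords : ∀ m → List (Word m)
  allWords zero    = [] ∷ []
  allWords (suc m) = cartesianProductWith _∷_ (allFin n) (allWords m)

  allWords-unique : ∀ m → Unique (allWords m)
  allWords-unique zero    = All.[] ∷ []
  allWords-unique (suc m) = cartesianProductWith⁺ _∷_ ∷-injective (allFin⁺ n) (allWords-unique m)

  ∈-allWords : ∀ {m} (y : Word m) → y ∈ allWords m
  ∈-allWords []      = here refl
  ∈-allWords (v ∷ y) = ∈-cartesianProductWith⁺ _∷_ (∈-allFin v) (∈-allWords y)

  enumerate : ∀ {m} → Pred m → List (Word m)
  enumerate {m} p = filter (T? ∘ p) (allWords m)

  enumerate-unique : ∀ {m} (p : Pred m) → Unique (enumerate p)
  enumerate-unique {m} p = filter⁺ (T? ∘ p) (allWords-unique m)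

  ∈-enumerate⁻ : ∀ {m} (p : Pred m) {y} → y ∈ enumerate p → T (p y)
  ∈-enumerate⁻ {m} p y∈ = proj₂ (∈-filter⁻ (T? ∘ p) {xs = allWords m} y∈)

  length-enumerate : ∀ {m} (p : Pred m) → length (enumerate p) ≡ count p
  length-enumerate p = ≤-antisym (length≤count p (enumerate-unique p) (∈-enumerate⁻ p))
    (count≤length p (enumerate p) (λ y py → ∈-filter⁺ (T? ∘ p) (∈-allWords y) py))

  intersecting⇒ν≤1 : ∀ {m} (p : Pred (suc m)) {F : Family (suc m) n} →
    Intersecting p → (∀ {A} → A ∈ F → T (p A)) → νLe F 1
  intersecting⇒ν≤1 p intersecting F⊆p []          _ = z≤n
  intersecting⇒ν≤1 p intersecting F⊆p (_ ∷ [])    _ = ≤-refl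
  intersecting⇒ν≤1 p intersecting F⊆p (a ∷ b ∷ _) (_ , M⊆F , (a⟂b All.∷ _) ∷ _)
    with intersecting (F⊆p (M⊆F (here refl))) (F⊆p (M⊆F (there (here refl))))
  ... | meet-at ℓ eq = ⊥-elim (a⟂b ℓ eq)

  nontrivial⇒1<τ : ∀ {m} (p : Pred (suc m)) {F : Family (suc m) n} →
    NonTrivial p → (∀ {A} → T (p A) → A ∈ F) → τGt F 1
  nontrivial⇒1<τ p nontrivial p⊆F [] (_ , covers) with nontrivial zero zero
  ... | A , pA , _ with covers (p⊆F pA)
  ...   | _ , () , _
  nontrivial⇒1<τ p nontrivial p⊆F ((ℓ , c) ∷ []) (_ , covers) with nontrivial ℓ c
  ... | A , pA , Aℓ≢c with covers (p⊆F pA)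
  ...   | _ , here refl , Aℓ≡c = ⊥-elim (Aℓ≢c Aℓ≡c)
  nontrivial⇒1<τ p nontrivial p⊆F (_ ∷ _ ∷ _) _ = s≤s (s≤s z≤n)

  member : ∀ {r} → Family r n → Pred r
  member F y = ⌊ Any.any? (y ≟ʷ_) F ⌋

  ν≤1⇒intersecting : ∀ {m} {F : Family (suc m) n} → νLe F 1 → Intersecting (member F)
  ν≤1⇒intersecting ν≤1 {a} {b} a∈F b∈F = decidable-stable (meet? a b) λ ¬meet →
    <⇒≱ (s≤s (s≤s z≤n)) (ν≤1 (a ∷ b ∷ [])
      ( ((λ a≡b → ¬meet (subst (Meet a) a≡b (meet-at zero refl))) All.∷ All.[]) ∷ All.[] ∷ []
      , (λ { (here refl) → toWitness a∈F ; (there (here refl)) → toWitness b∈F })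
      , ((λ ℓ eq → ¬meet (meet-at ℓ eq)) All.∷ All.[]) ∷ All.[] ∷ []))

  1<τ⇒nontrivial : ∀ {m} {F : Family m n} → τGt F 1 → NonTrivial (member F)
  1<τ⇒nontrivial {F = F} 1<τ ℓ c =
    decidable-stable (misses-vertex? (member F) ℓ c) λ none →
      <-irrefl refl (1<τ ((ℓ , c) ∷ []) ( All.[] ∷ []
        , λ {A} A∈F → (ℓ , c) , here refl ,
            decidable-stable (lookup A ℓ ≟ c) (λ Aℓ≢c → none (A , fromWitness A∈F , Aℓ≢c))))

  admissible⇒length≤ : ∀ m (F : Family (suc (suc (suc m))) n) → Admissible 1 F →
    length F ≤ #meet (suc (suc m)) + suc k
  admissible⇒length≤ m F (unique , ν≤1 , 1<τ) = ≤-trans (length≤count (member F) unique fromWitness)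
    (main-bound m (member F) (ν≤1⇒intersecting ν≤1) (1<τ⇒nontrivial 1<τ))

  extremal-admissible : ∀ m → Admissible 1 (enumerate (extremal {suc (suc m)}))
  extremal-admissible m = enumerate-unique E
    , intersecting⇒ν≤1 E extremal-intersecting (∈-enumerate⁻ E)
    , nontrivial⇒1<τ E extremal-nontrivial (λ {A} EA → ∈-filter⁺ (T? ∘ E) (∈-allWords A) EA)
    where
    E : Pred (suc (suc (suc m)))
    E = extremal

  m₀-value : ∀ m → IsM0 1 n (suc (suc (suc m))) (#meet (suc (suc m)) + suc k)
  m₀-value m = (enumerate E , extremal-admissible m , trans (length-enumerate E) (count-extremal (suc (suc m))))
             , admissible⇒length≤ m
    where
    E : Pred (suc (suc (suc m)))
    E = extremal

theorem1p6 : ∀ (r n : ℕ) → 3 ≤ r → 2 ≤ n →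
    IsM0 1 n r ((n ^ (r ∸ 1) ∸ (n ∸ 1) ^ (r ∸ 1)) + (n ∸ 1))
theorem1p6 _ _ (s≤s (s≤s (s≤s {n = m} z≤n))) (s≤s (s≤s {n = k} z≤n)) =
  subst (IsM0 1 n (3 + m)) (cong (_+ suc k) (#meet≡n^∸#avoid (2 + m))) (m₀-value m)
  where open Cube k
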